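{- Let $K$ be an imaginary quadratic extension of $\mathbb{Q}$, let $S$ be a finite nonempty set of non-archimedean places of $K$, and let $\mathcal{O}_{K,S}$ be the ring of $S$-integers of $K$. Let $p_1,\dots,p_k$ be the distinct rational primes lying below the primes of $S$, and let $I=\{0,1,2,3,4\}^k$. For every $x,y,z\in\mathcal{O}_{K,S}^\times$ there exists $\beta\in I$ such that $v_{\mathfrak p}(p^\beta x)\neq 0$ and $v_{\mathfrak p}(p^\beta z)\neq v_{\mathfrak p}(y)$ for every prime $\mathfrak p\in S$.
   Context: $\mathcal{O}_{K,S}=\{x\in K : \operatorname{ord}_{\mathfrak p}(x)\ge 0 \text{ for all non-archimedean places } \mathfrak p\notin S\}$ and $\mathcal{O}_{K,S}^\times$ is its unit group. For a multi-index $\beta=(\beta_1,\dots,\beta_k)$, $p^\beta=\prod_{i=1}^k p_i^{\beta_i}$. $v_{\mathfrak p}$ denotes the normalized discrete valuation of $K$ at $\mathfrak p$. -}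

module Defs where

open import Data.Nat as ℕ using (ℕ; suc)
open import Data.Nat.Divisibility using (_∣_)
open import Data.Nat.Primality using (Prime)
open import Data.Integer as ℤ using (ℤ; +_)
open import Data.Rational as ℚ using (ℚ; 0ℚ; 1ℚ)
open import Data.Fin using (Fin; toℕ)
open import Data.Vec using (Vec; []; _∷_)
open import Data.List using (List; []; _∷_)
open import Data.List.Relation.Unary.Any using (Any)
open import Data.List.Relation.Unary.AllPairs using (AllPairs)
open import Data.Product using (_×_; _,_; ∃; proj₁; proj₂)
open import Relation.Binary.PropositionalEquality using (_≡_; _≢_)
open import Relation.Nullary using (¬_)

SquareFree : ℕ → Set
SquareFree d = ∀ n → n ℕ.* n ∣ d → n ≡ 1

-- The imaginary quadratic field K = ℚ(√-d), d ≥ 1 squarefree.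
-- An element (a , b) represents a + b·√-d.
K : Set
K = ℚ × ℚ

0K : K
0K = 0ℚ , 0ℚ

1K : K
1K = 1ℚ , 0ℚ

ℕ→ℚ : ℕ → ℚ
ℕ→ℚ n = (+ n) ℚ./ 1

ι : ℕ → K
ι n = ℕ→ℚ n , 0ℚ

addK : K → K → K
addK (a , b) (c , e) = a ℚ.+ c , b ℚ.+ e

-- multiplication in ℚ(√-d): (a + b√-d)(c + e√-d) = (ac - d·be) + (ae + bc)√-d
mulK : ℕ → K → K → K
mulK d (a , b) (c , e) = (a ℚ.* c) ℚ.- (ℕ→ℚ d ℚ.* (b ℚ.* e)) , (a ℚ.* e) ℚ.+ (b ℚ.* c)

powK : ℕ → K → ℕ → K
powK d x ℕ.zero = 1K
powK d x (suc n) = mulK d x (powK d x n)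

-- A non-archimedean place of K, given by its normalized discrete valuation
-- v : K^× → ℤ (surjective homomorphism with the ultrametric inequality).
-- The value at 0 is irrelevant (no axiom constrains it).
record Valuation (d : ℕ) : Set where
  field
    v      : K → ℤ
    v-mul  : ∀ x y → x ≢ 0K → y ≢ 0K → v (mulK d x y) ≡ v x ℤ.+ v y
    v-ultr : ∀ x y → x ≢ 0K → y ≢ 0K → addK x y ≢ 0K →
             (v x ℤ.⊓ v y) ℤ.≤ v (addK x y)
    v-surj : ∀ n → ∃ λ x → x ≢ 0K × v x ≡ n
open Valuation public

SamePlace : ∀ {d} → Valuation d → Valuation d → Set
SamePlace w w' = ∀ x → x ≢ 0K → v w x ≡ v w' x

InS : ∀ {d} → Valuation d → List (Valuation d) → Set
InS w S = Any (SamePlace w) S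

DistinctPlaces : ∀ {d} → List (Valuation d) → Set
DistinctPlaces S = AllPairs (λ w w' → ¬ SamePlace w w') S

IsSInteger : ∀ {d} → List (Valuation d) → K → Set
IsSInteger S x = ∀ w → ¬ InS w S → x ≢ 0K → + 0 ℤ.≤ v w x

IsSUnit : (d : ℕ) → List (Valuation d) → K → Set
IsSUnit d S x = IsSInteger S x × ∃ λ y → IsSInteger S y × mulK d x y ≡ 1K

BelowS : ∀ {d} → List (Valuation d) → ℕ → Set
BelowS S p = Prime p × Any (λ w → + 0 ℤ.< v w (ι p)) S

pPow : (d : ℕ) → ∀ {k} → Vec ℕ k → Vec (Fin 5) k → K
pPow d [] [] = 1K
pPow d (p ∷ ps) (b ∷ bs) = mulK d (powK d (ι p) (toℕ b)) (pPow d ps bs)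

-- Let p be the residue characteristic of a place w ∈ S. The other primes of the list are w-units,
-- so v_w(p^β γ) = β_p e_w + v_w(γ) with e_w = v_w(p) > 0, and β_p has to avoid the roots of
-- these affine functions for γ ∈ {x, z/y} and for all w ∈ S above p. Fix one reference place w₀
-- above p. Scaled by e_w₀ resp. e_w, the valuations w and w₀ agree on ℚ^× (both are multiples of
-- the p-adic valuation), hence, via the norm and trace of γ, e_w₀ · {v_w(γ), v_w(γ̄)} equals
-- e_w · {v_w₀(γ), v_w₀(γ̄)}. So every root for w is a root for w₀ at γ or at γ̄, leaving at most
-- four values to avoid, and one of 0, …, 4 does.

module Submission where

open import Defs
open import Data.Nat using (ℕ; _≤_)
open import Data.Integer using (+_)
open import Data.Fin using (Fin)
open import Data.Vec using (Vec)
open import Data.Vec.Relation.Unary.Unique.Propositional using (Unique)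
open import Data.Vec.Membership.Propositional using (_∈_)
open import Data.List using (List; [])
open import Data.List.Relation.Unary.All using (All)
open import Data.Product using (_×_; ∃)
open import Relation.Binary.PropositionalEquality using (_≢_)
open import Function.Bundles using (_⇔_)

open import Data.Fin as Fin using (toℕ; #_)
open import Data.Integer as ℤ using (ℤ; -[1+_]; +[1+_]; _⊓_)
open import Data.Integer.Solver using () renaming (module +-*-Solver to ℤ-Solver)
open import Data.List using (_∷_)
open import Data.List.Relation.Unary.All using ([]; _∷_)
open import Data.Nat as ℕ using (zero; suc)
open import Data.Nat.Coprimality using (Coprime; coprime-Bézout)
open import Data.Nat.GCD using (module Bézout)
open import Data.Nat.ListAction using (product)
open import Data.Nat.Primality using (Prime; prime⇒irreducible; ¬prime[1]; prime⇒nonZero; productOfPrimes≢0)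
open import Data.Nat.Primality.Factorisation using (factorise; PrimeFactorisation)
open import Data.Product using (_,_; proj₁; proj₂)
open import Data.Product.Properties using (≡-dec)
open import Data.Rational as ℚ using (ℚ; mkℚ; 0ℚ; 1ℚ; _/_)
open import Data.Rational.Solver using () renaming (module +-*-Solver to ℚ-Solver)
open import Data.Sum using (_⊎_; inj₁; inj₂; [_,_]′)
open import Data.Vec using (lookup; tabulate; []; _∷_)
open import Data.Vec.Membership.Propositional.Properties using (∈-lookup)
open import Data.Vec.Properties using (lookup∘tabulate)
open import Data.Vec.Relation.Unary.Any.Properties using (lookup-index)
open import Data.Vec.Relation.Unary.Unique.Propositional.Properties using (lookup-injective)
open import Function using (_∘_)
open import Function.Bundles using (Equivalence)
open import Relation.Binary.Definitions using (DecidableEquality; tri<; tri≈; tri>)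
open import Relation.Binary.PropositionalEquality
open import Relation.Nullary using (¬_; Dec; yes; no; contradiction)

import Data.Fin.Properties as FinP
import Data.Integer.Properties as ℤP
import Data.List.Membership.Propositional as List
import Data.List.Relation.Unary.All as All
import Data.List.Relation.Unary.Any as ListAny
import Data.Nat.Coprimality as Coprimality
import Data.Nat.Properties as ℕP
import Data.Product as Product
import Data.Rational.Properties as ℚP
import Data.Rational.Unnormalised as ℚᵘ
import Data.Sum as Sum
import Data.Vec.Relation.Unary.Any as VecAny

open import Algebra.Properties.AbelianGroup ℤP.+-0-abelianGroup using ()
  renaming (∙-cancelʳ to +-cancelʳ; identityʳ-unique to +-identityʳ-unique)

i+i≡j+j⇒i≡j : ∀ {i j} → i ℤ.+ i ≡ j ℤ.+ j → i ≡ j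
i+i≡j+j⇒i≡j {i} {j} eq with ℤP.<-cmp i j
... | tri< i<j _ _ = contradiction eq (ℤP.<⇒≢ (ℤP.+-mono-< i<j i<j))
... | tri≈ _ i≡j _ = i≡j
... | tri> _ _ i>j = contradiction (sym eq) (ℤP.<⇒≢ (ℤP.+-mono-< i>j i>j))

i≢j⇒i⊓j+i⊓j<i+j : ∀ {i j} → i ≢ j → i ⊓ j ℤ.+ i ⊓ j ℤ.< i ℤ.+ j
i≢j⇒i⊓j+i⊓j<i+j {i} {j} i≢j with ℤP.<-cmp i j
... | tri< i<j _ _ rewrite ℤP.i≤j⇒i⊓j≡i (ℤP.<⇒≤ i<j) = ℤP.+-monoʳ-< i i<j
... | tri≈ _ i≡j _ = contradiction i≡j i≢j
... | tri> _ _ i>j rewrite ℤP.i≥j⇒i⊓j≡j (ℤP.<⇒≤ i>j) = ℤP.+-monoˡ-< j i>j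

-- What the ultrametric inequality (and its strict case) says about τ = v (x + y) when a = v x, b = v y.
UltrametricValue : ℤ → ℤ → ℤ → Set
UltrametricValue a b τ = a ⊓ b ℤ.≤ τ × (a ≢ b → τ ≡ a ⊓ b)

ultrametricValue-scale : ∀ c {a b τ} → .{{ℤ.NonNegative c}} →
  UltrametricValue a b τ → UltrametricValue (c ℤ.* a) (c ℤ.* b) (c ℤ.* τ)
ultrametricValue-scale c {a} {b} (min≤τ , a≢b⇒τ≡min) =
    subst (ℤ._≤ c ℤ.* _) c*min≡ (ℤP.*-monoˡ-≤-nonNeg c min≤τ)
  , λ ca≢cb → trans (cong (c ℤ.*_) (a≢b⇒τ≡min (λ a≡b → ca≢cb (cong (c ℤ.*_) a≡b)))) c*min≡
  where
  c*min≡ : c ℤ.* (a ⊓ b) ≡ (c ℤ.* a) ⊓ (c ℤ.* b)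
  c*min≡ = ℤP.mono-≤-distrib-⊓ (ℤP.*-monoˡ-≤-nonNeg c) a b

ultrametricValue-equal : ∀ {X τ Y Y′} → X ℤ.+ X ≡ Y ℤ.+ Y′ →
  UltrametricValue X X τ → UltrametricValue Y Y′ τ → Y ≡ Y′
ultrametricValue-equal {X} {τ} {Y} {Y′} sum≡ (X⊓X≤τ , _) (_ , τY) with Y ℤP.≟ Y′
... | yes Y≡Y′ = Y≡Y′
... | no Y≢Y′ = contradiction (begin-strict
  X ℤ.+ X            ≤⟨ ℤP.+-mono-≤ X≤τ X≤τ ⟩
  τ ℤ.+ τ            ≡⟨ cong₂ ℤ._+_ (τY Y≢Y′) (τY Y≢Y′) ⟩
  Y ⊓ Y′ ℤ.+ Y ⊓ Y′  <⟨ i≢j⇒i⊓j+i⊓j<i+j Y≢Y′ ⟩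
  Y ℤ.+ Y′           ≡⟨ sym sum≡ ⟩
  X ℤ.+ X            ∎) (ℤP.<-irrefl refl)
  where
  open ℤP.≤-Reasoning
  X≤τ : X ℤ.≤ τ
  X≤τ = subst (ℤ._≤ τ) (ℤP.⊓-idem X) X⊓X≤τ

sum-and-min-determine-pair : ∀ {X X′ Y Y′} → X ℤ.+ X′ ≡ Y ℤ.+ Y′ → X ⊓ X′ ≡ Y ⊓ Y′ → Y ≡ X ⊎ Y ≡ X′
sum-and-min-determine-pair {X} {X′} {Y} {Y′} sum≡ min≡ with ℤP.⊓-sel X X′ | ℤP.⊓-sel Y Y′
... | inj₁ m≡X  | inj₁ m≡Y  = inj₁ (trans (sym m≡Y) (trans (sym min≡) m≡X))
... | inj₂ m≡X′ | inj₁ m≡Y  = inj₂ (trans (sym m≡Y) (trans (sym min≡) m≡X′))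
... | inj₁ m≡X  | inj₂ m≡Y′ = inj₂ (sym (+-cancelʳ X X′ Y (begin
  X′ ℤ.+ X  ≡⟨ ℤP.+-comm X′ X ⟩
  X ℤ.+ X′  ≡⟨ sum≡ ⟩
  Y ℤ.+ Y′  ≡⟨ cong (ℤ._+_ Y) (trans (sym m≡Y′) (trans (sym min≡) m≡X)) ⟩
  Y ℤ.+ X   ∎)))
  where open ≡-Reasoning
... | inj₂ m≡X′ | inj₂ m≡Y′ =
  inj₁ (sym (+-cancelʳ X′ X Y (trans sum≡ (cong (ℤ._+_ Y) (trans (sym m≡Y′) (trans (sym min≡) m≡X′))))))

ultrametricValue-pair : ∀ {X X′ Y Y′ τ} → X ℤ.+ X′ ≡ Y ℤ.+ Y′ →
  UltrametricValue X X′ τ → UltrametricValue Y Y′ τ → Y ≡ X ⊎ Y ≡ X′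
ultrametricValue-pair {X} {X′} {Y} {Y′} sum≡ uX@(_ , τX) uY@(_ , τY) with X ℤP.≟ X′ | Y ℤP.≟ Y′
... | no X≢X′ | no Y≢Y′ = sum-and-min-determine-pair sum≡ (trans (sym (τX X≢X′)) (τY Y≢Y′))
... | yes refl | no Y≢Y′ = contradiction (ultrametricValue-equal sum≡ uX uY) Y≢Y′
... | no X≢X′ | yes refl = contradiction (ultrametricValue-equal (sym sum≡) uY uX) X≢X′
... | yes refl | yes refl = inj₁ (sym (i+i≡j+j⇒i≡j sum≡))

proportional⇒same-root : ∀ {e e′ c c′} n → e′ ≢ + 0 → n ℤ.* e′ ℤ.+ c′ ≡ + 0 →
  e ℤ.* c′ ≡ e′ ℤ.* c → n ℤ.* e ℤ.+ c ≡ + 0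
proportional⇒same-root {e} {e′} {c} {c′} n e′≢0 root′ ec′≡e′c =
  ℤP.*-cancelˡ-≡ e′ (n ℤ.* e ℤ.+ c) (+ 0) {{ℤ.≢-nonZero e′≢0}} (begin
    e′ ℤ.* (n ℤ.* e ℤ.+ c)          ≡⟨ solve 4 (λ e e′ c n → e′ :* (n :* e :+ c) := e :* (n :* e′) :+ e′ :* c) refl e e′ c n ⟩
    e ℤ.* (n ℤ.* e′) ℤ.+ e′ ℤ.* c   ≡⟨ cong (ℤ._+_ (e ℤ.* (n ℤ.* e′))) ec′≡e′c ⟨
    e ℤ.* (n ℤ.* e′) ℤ.+ e ℤ.* c′   ≡⟨ ℤP.*-distribˡ-+ e (n ℤ.* e′) c′ ⟨
    e ℤ.* (n ℤ.* e′ ℤ.+ c′)         ≡⟨ cong (e ℤ.*_) root′ ⟩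
    e ℤ.* + 0                       ≡⟨ ℤP.*-zeroʳ e ⟩
    + 0                             ≡⟨ ℤP.*-zeroʳ e′ ⟨
    e′ ℤ.* + 0                      ∎)
  where
  open ≡-Reasoning
  open ℤ-Solver using (solve; _:=_; _:+_; _:*_)

exponent-avoiding : ∀ {n} e → e ≢ + 0 → (c : Fin n → ℤ) →
  ∃ λ (b : Fin (suc n)) → ∀ j → + toℕ b ℤ.* e ℤ.+ c j ≢ + 0
exponent-avoiding {n} e e≢0 c =
  Product.map₂ (λ b-misses j root → b-misses (j , root)) (FinP.¬∀⟶∃¬ (suc n) Hits hits? not-all-hit)
  where
  Hits : Fin (suc n) → Set
  Hits b = ∃ λ j → + toℕ b ℤ.* e ℤ.+ c j ≡ + 0
  hits? : ∀ b → Dec (Hits b)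
  hits? b = FinP.any? (λ j → + toℕ b ℤ.* e ℤ.+ c j ℤP.≟ + 0)
  -- Pigeonhole: each value c j is hit by at most one b.
  not-all-hit : ¬ (∀ b → Hits b)
  not-all-hit hit with FinP.pigeonhole (ℕP.n<1+n n) (proj₁ ∘ hit)
  ... | b₁ , b₂ , b₁<b₂ , same-j = ℕP.<⇒≢ b₁<b₂ (ℤP.+-injective (ℤP.*-cancelʳ-≡ _ _ e {{ℤ.≢-nonZero e≢0}}
          (+-cancelʳ (c j) _ _ (trans root₁ (sym (proj₂ (hit b₂)))))))
    where
    j : Fin n
    j = proj₁ (hit b₂)
    root₁ : + toℕ b₁ ℤ.* e ℤ.+ c j ≡ + 0
    root₁ = subst (λ t → + toℕ b₁ ℤ.* e ℤ.+ c t ≡ + 0) same-j (proj₂ (hit b₁))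

prime≢0 : ∀ {p} → Prime p → p ≢ 0
prime≢0 {p} p-prime = ℕ.≢-nonZero⁻¹ p {{prime⇒nonZero p-prime}}

distinct-primes-coprime : ∀ {p q} → Prime p → Prime q → p ≢ q → Coprime p q
distinct-primes-coprime p-prime q-prime p≢q (c∣p , c∣q) with prime⇒irreducible p-prime c∣p
... | inj₁ c≡1 = c≡1
... | inj₂ refl with prime⇒irreducible q-prime c∣q
...   | inj₁ refl = contradiction p-prime ¬prime[1]
...   | inj₂ p≡q = contradiction p≡q p≢q

record CompletelyAdditive (f : ℕ → ℤ) : Set where
  field
    additive : ∀ m n → m ≢ 0 → n ≢ 0 → f (m ℕ.* n) ≡ f m ℤ.+ f n
open CompletelyAdditive

module _ {f : ℕ → ℤ} (f-additive : CompletelyAdditive f) where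

  additive-1 : f 1 ≡ + 0
  additive-1 = +-identityʳ-unique (f 1) (f 1) (sym (additive f-additive 1 1 (λ ()) (λ ())))

  additive-∷ : ∀ {q qs} → Prime q → All Prime qs → f (product (q ∷ qs)) ≡ f q ℤ.+ f (product qs)
  additive-∷ q-prime qs-prime =
    additive f-additive _ _ (prime≢0 q-prime) (ℕ.≢-nonZero⁻¹ _ {{productOfPrimes≢0 qs-prime}})

  positive-prime-factor : ∀ n → n ≢ 0 → + 0 ℤ.< f n → ∃ λ q → Prime q × + 0 ℤ.< f q
  positive-prime-factor n n≢0 0<fn =
    on-products factorsPrime (subst (λ m → + 0 ℤ.< f m) isFactorisation 0<fn)
    where
    instance
      n-nonZero : ℕ.NonZero n
      n-nonZero = ℕ.≢-nonZero n≢0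
    open PrimeFactorisation (factorise n)
    on-products : ∀ {qs} → All Prime qs → + 0 ℤ.< f (product qs) → ∃ λ q → Prime q × + 0 ℤ.< f q
    on-products [] 0<f1 = contradiction (sym additive-1) (ℤP.<⇒≢ 0<f1)
    on-products {q ∷ qs} (q-prime ∷ qs-prime) 0<f with + 0 ℤP.<? f q
    ... | yes 0<fq = q , q-prime , 0<fq
    ... | no 0≮fq = on-products qs-prime (begin-strict
      + 0                       <⟨ 0<f ⟩
      f (product (q ∷ qs))      ≡⟨ additive-∷ q-prime qs-prime ⟩
      f q ℤ.+ f (product qs)    ≤⟨ ℤP.+-monoˡ-≤ _ (ℤP.≮⇒≥ 0≮fq) ⟩
      + 0 ℤ.+ f (product qs)    ≡⟨ ℤP.+-identityˡ _ ⟩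
      f (product qs)            ∎)
      where open ℤP.≤-Reasoning

agree-on-primes⇒agree : ∀ {f g} → CompletelyAdditive f → CompletelyAdditive g →
  (∀ q → Prime q → f q ≡ g q) → ∀ n → n ≢ 0 → f n ≡ g n
agree-on-primes⇒agree {f} {g} f-additive g-additive f≡g n n≢0 =
  subst (λ m → f m ≡ g m) (sym isFactorisation) (on-products factorsPrime)
  where
  instance
    n-nonZero : ℕ.NonZero n
    n-nonZero = ℕ.≢-nonZero n≢0
  open PrimeFactorisation (factorise n)
  on-products : ∀ {qs} → All Prime qs → f (product qs) ≡ g (product qs)
  on-products [] = trans (additive-1 f-additive) (sym (additive-1 g-additive))
  on-products {q ∷ qs} (q-prime ∷ qs-prime) = begin
    f (product (q ∷ qs))       ≡⟨ additive-∷ f-additive q-prime qs-prime ⟩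
    f q ℤ.+ f (product qs)     ≡⟨ cong₂ ℤ._+_ (f≡g q q-prime) (on-products qs-prime) ⟩
    g q ℤ.+ g (product qs)     ≡⟨ additive-∷ g-additive q-prime qs-prime ⟨
    g (product (q ∷ qs))       ∎
    where open ≡-Reasoning

module NonArchimedeanOnℕ {f : ℕ → ℤ} (f-additive : CompletelyAdditive f)
  (f-nonneg : ∀ {n} → n ≢ 0 → + 0 ℤ.≤ f n)
  (f-suc : ∀ {n} → n ≢ 0 → + 0 ℤ.< f n → f (suc n) ≡ + 0) where

  private
    InIdeal : ℕ → Set
    InIdeal n = n ≡ 0 ⊎ + 0 ℤ.< f n

    inIdeal-* : ∀ k {n} → InIdeal n → InIdeal (k ℕ.* n)
    inIdeal-* k (inj₁ refl) = inj₁ (ℕP.*-zeroʳ k)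
    inIdeal-* zero (inj₂ _) = inj₁ refl
    inIdeal-* (suc k) {zero} (inj₂ _) = inj₁ (ℕP.*-zeroʳ (suc k))
    inIdeal-* (suc k) {suc n} (inj₂ 0<fn) = inj₂ (subst (+ 0 ℤ.<_)
      (sym (additive f-additive (suc k) (suc n) (λ ()) (λ ()))) (ℤP.+-mono-≤-< (f-nonneg {suc k} (λ ())) 0<fn))

    inIdeal-suc : ∀ {n} → InIdeal n → ¬ InIdeal (suc n)
    inIdeal-suc _ (inj₁ ())
    inIdeal-suc {zero} _ (inj₂ 0<f1) = ℤP.<⇒≢ 0<f1 (sym (additive-1 f-additive))
    inIdeal-suc {suc n} (inj₁ ())
    inIdeal-suc {suc n} (inj₂ 0<fn) (inj₂ 0<fsn) = ℤP.<⇒≢ 0<fsn (sym (f-suc {suc n} (λ ()) 0<fn))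

  -- Were f m > 0 as well, Bézout would put two consecutive numbers into InIdeal.
  coprime-to-positive⇒zero : ∀ {p m} → Coprime p m → + 0 ℤ.< f p → m ≢ 0 → f m ≡ + 0
  coprime-to-positive⇒zero {p} {m} p⊥m 0<fp m≢0 = ℤP.≤-antisym (ℤP.≮⇒≥ 0≮fm) (f-nonneg m≢0)
    where
    0≮fm : ¬ (+ 0 ℤ.< f m)
    0≮fm 0<fm with coprime-Bézout p⊥m
    ... | Bézout.+- x y eq =
      inIdeal-suc (inIdeal-* y (inj₂ 0<fm)) (subst InIdeal (sym eq) (inIdeal-* x (inj₂ 0<fp)))
    ... | Bézout.-+ x y eq =
      inIdeal-suc (inIdeal-* x (inj₂ 0<fp)) (subst InIdeal (sym eq) (inIdeal-* y (inj₂ 0<fm)))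

  other-prime⇒zero : ∀ {p q} → Prime p → Prime q → p ≢ q → + 0 ℤ.< f p → f q ≡ + 0
  other-prime⇒zero p-prime q-prime p≢q 0<fp =
    coprime-to-positive⇒zero (distinct-primes-coprime p-prime q-prime p≢q) 0<fp (prime≢0 q-prime)

completelyAdditive-scale : ∀ c {f} → CompletelyAdditive f → CompletelyAdditive (λ n → c ℤ.* f n)
completelyAdditive-scale c {f} f-additive = record { additive = λ m n m≢0 n≢0 →
  trans (cong (c ℤ.*_) (additive f-additive m n m≢0 n≢0)) (ℤP.*-distribˡ-+ c (f m) (f n)) }

private
  i/1≡mkℚ : ∀ i → i / 1 ≡ mkℚ i 0 (Coprimality.sym (Coprimality.1-coprimeTo ℤ.∣ i ∣))
  i/1≡mkℚ i = ℚP.↥p/↧p≡p (mkℚ i 0 _)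

  i/1-+ : ∀ i j → (i ℤ.+ j) / 1 ≡ i / 1 ℚ.+ j / 1
  i/1-+ i j = trans (cong (_/ 1) (cong₂ ℤ._+_ (sym (ℤP.*-identityʳ i)) (sym (ℤP.*-identityʳ j))))
                    (sym (cong₂ ℚ._+_ (i/1≡mkℚ i) (i/1≡mkℚ j)))

  i/1-* : ∀ i j → (i ℤ.* j) / 1 ≡ (i / 1) ℚ.* (j / 1)
  i/1-* i j = sym (cong₂ ℚ._*_ (i/1≡mkℚ i) (i/1≡mkℚ j))

ℕ→ℚ-+ : ∀ m n → ℕ→ℚ (m ℕ.+ n) ≡ ℕ→ℚ m ℚ.+ ℕ→ℚ n
ℕ→ℚ-+ m n = trans (cong (_/ 1) (ℤP.pos-+ m n)) (i/1-+ (+ m) (+ n))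

ℕ→ℚ-* : ∀ m n → ℕ→ℚ (m ℕ.* n) ≡ ℕ→ℚ m ℚ.* ℕ→ℚ n
ℕ→ℚ-* m n = trans (cong (_/ 1) (ℤP.pos-* m n)) (i/1-* (+ m) (+ n))

ℕ→ℚ-≡0 : ∀ {n} → ℕ→ℚ n ≡ 0ℚ → n ≡ 0
ℕ→ℚ-≡0 {n} eq = ℤP.+-injective (trans (cong ℚ.↥_ (sym (i/1≡mkℚ (+ n)))) (ℚP.p≡0⇒↥p≡0 _ eq))

*-denominator : ∀ r → r ℚ.* ℕ→ℚ (ℚ.↧ₙ r) ≡ ℚ.↥ r / 1
*-denominator r@(mkℚ n d-1 _) = trans (cong (r ℚ.*_) (i/1≡mkℚ (+ suc d-1)))
  (ℚP.fromℚᵘ-cong {ℚᵘ.mkℚᵘ (n ℤ.* + suc d-1) (d-1 ℕ.* 1)} {ℚᵘ.mkℚᵘ n 0} (ℚᵘ.*≡* cross))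
  where
  cross : n ℤ.* + suc d-1 ℤ.* + 1 ≡ n ℤ.* + suc (d-1 ℕ.* 1)
  cross = trans (ℤP.*-identityʳ _) (cong (λ t → n ℤ.* + suc t) (sym (ℕP.*-identityʳ d-1)))

p≢0∧p*q≡0⇒q≡0 : ∀ {p q} → p ≢ 0ℚ → p ℚ.* q ≡ 0ℚ → q ≡ 0ℚ
p≢0∧p*q≡0⇒q≡0 {p} {q} p≢0 pq≡0 = begin
  q                       ≡⟨ ℚP.*-identityˡ q ⟨
  1ℚ ℚ.* q                ≡⟨ cong (ℚ._* q) (ℚP.*-inverseˡ p) ⟨
  ℚ.1/ p ℚ.* p ℚ.* q      ≡⟨ ℚP.*-assoc (ℚ.1/ p) p q ⟩
  ℚ.1/ p ℚ.* (p ℚ.* q)    ≡⟨ cong (ℚ.1/ p ℚ.*_) pq≡0 ⟩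
  ℚ.1/ p ℚ.* 0ℚ           ≡⟨ ℚP.*-zeroʳ (ℚ.1/ p) ⟩
  0ℚ                      ∎
  where
  open ≡-Reasoning
  instance
    p-nonZero : ℚ.NonZero p
    p-nonZero = ℚ.≢-nonZero p≢0

a+a≢0 : ∀ {a} → a ≢ 0ℚ → a ℚ.+ a ≢ 0ℚ
a+a≢0 {a} a≢0 a+a≡0 = a≢0 (p≢0∧p*q≡0⇒q≡0 {1ℚ ℚ.+ 1ℚ} (λ ())
  (trans (solve 1 (λ a → (con 1ℚ :+ con 1ℚ) :* a := a :+ a) refl a) a+a≡0))
  where open ℚ-Solver using (solve; _:=_; _:+_; _:*_; con)

p*p≥0 : ∀ p → 0ℚ ℚ.≤ p ℚ.* p
p*p≥0 p@(mkℚ +[1+ _ ] _ _) = ℚP.nonNegative⁻¹ (p ℚ.* p) {{ℚP.pos⇒nonNeg (p ℚ.* p) {{ℚP.pos*pos⇒pos p p}}}}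
p*p≥0 p@(mkℚ (+ 0) _ _) = subst (λ q → 0ℚ ℚ.≤ q ℚ.* q) (sym (ℚP.↥p≡0⇒p≡0 p refl)) ℚP.≤-refl
p*p≥0 p@(mkℚ -[1+ _ ] _ _) = ℚP.nonNegative⁻¹ (p ℚ.* p) {{ℚP.pos⇒nonNeg (p ℚ.* p) {{ℚP.neg*neg⇒pos p p}}}}

p≢0⇒p*p>0 : ∀ {p} → p ≢ 0ℚ → 0ℚ ℚ.< p ℚ.* p
p≢0⇒p*p>0 {p@(mkℚ +[1+ _ ] _ _)} _ = ℚP.positive⁻¹ (p ℚ.* p) {{ℚP.pos*pos⇒pos p p}}
p≢0⇒p*p>0 {p@(mkℚ (+ 0) _ _)} p≢0 = contradiction (ℚP.↥p≡0⇒p≡0 p refl) p≢0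
p≢0⇒p*p>0 {p@(mkℚ -[1+ _ ] _ _)} _ = ℚP.positive⁻¹ (p ℚ.* p) {{ℚP.neg*neg⇒pos p p}}

module QuadraticField (d : ℕ) where

  open ℚ-Solver using (solve; _:=_; _:+_; _:*_; _:-_; :-_; con)

  infixl 7 _·_
  infixl 6 _+ᴷ_
  infix 8 -ᴷ_

  _·_ : K → K → K
  _·_ = mulK d

  _+ᴷ_ : K → K → K
  _+ᴷ_ = addK

  -ᴷ_ : K → K
  -ᴷ (a , b) = ℚ.- a , ℚ.- b

  D : ℚ
  D = ℕ→ℚ d

  fromℚ : ℚ → K
  fromℚ r = r , 0ℚ

  conj : K → K
  conj (a , b) = a , ℚ.- b

  √-d : K
  √-d = 0ℚ , 1ℚ

  norm : K → ℚ
  norm (a , b) = a ℚ.* a ℚ.+ D ℚ.* (b ℚ.* b)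

  ·-comm : ∀ x y → x · y ≡ y · x
  ·-comm (a , b) (c , e) = cong₂ _,_
    (solve 5 (λ a b c e D → a :* c :- D :* (b :* e) := c :* a :- D :* (e :* b)) refl a b c e D)
    (solve 4 (λ a b c e → a :* e :+ b :* c := c :* b :+ e :* a) refl a b c e)

  ·-identityˡ : ∀ x → 1K · x ≡ x
  ·-identityˡ (a , b) = cong₂ _,_
    (solve 3 (λ a b D → con 1ℚ :* a :- D :* (con 0ℚ :* b) := a) refl a b D)
    (solve 2 (λ a b → con 1ℚ :* b :+ con 0ℚ :* a := b) refl a b)

  ·-zeroʳ : ∀ x → x · 0K ≡ 0K
  ·-zeroʳ (a , b) = cong₂ _,_
    (solve 3 (λ a b D → a :* con 0ℚ :- D :* (b :* con 0ℚ) := con 0ℚ) refl a b D)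
    (solve 2 (λ a b → a :* con 0ℚ :+ b :* con 0ℚ := con 0ℚ) refl a b)

  ·-zeroˡ : ∀ x → 0K · x ≡ 0K
  ·-zeroˡ x = trans (·-comm 0K x) (·-zeroʳ x)

  fromℚ-· : ∀ r s → fromℚ r · fromℚ s ≡ fromℚ (r ℚ.* s)
  fromℚ-· r s = cong₂ _,_
    (solve 3 (λ r s D → r :* s :- D :* (con 0ℚ :* con 0ℚ) := r :* s) refl r s D)
    (solve 2 (λ r s → r :* con 0ℚ :+ con 0ℚ :* s := con 0ℚ) refl r s)

  fromℚ-+ : ∀ r s → fromℚ r +ᴷ fromℚ s ≡ fromℚ (r ℚ.+ s)
  fromℚ-+ r s = cong (r ℚ.+ s ,_) (ℚP.+-identityʳ 0ℚ)

  -ᴷ-as-· : ∀ x → -ᴷ x ≡ fromℚ (ℚ.- 1ℚ) · x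
  -ᴷ-as-· (a , b) = cong₂ _,_
    (solve 3 (λ a b D → :- a := :- con 1ℚ :* a :- D :* (con 0ℚ :* b)) refl a b D)
    (solve 2 (λ a b → :- b := :- con 1ℚ :* b :+ con 0ℚ :* a) refl a b)

  +ᴷ-identityˡ : ∀ x → 0K +ᴷ x ≡ x
  +ᴷ-identityˡ (a , b) = cong₂ _,_ (ℚP.+-identityˡ a) (ℚP.+-identityˡ b)

  +ᴷ-comm : ∀ x y → x +ᴷ y ≡ y +ᴷ x
  +ᴷ-comm (a , b) (c , e) = cong₂ _,_ (ℚP.+-comm a c) (ℚP.+-comm b e)

  +ᴷ--ᴷ-cancel : ∀ x y → x +ᴷ y +ᴷ -ᴷ y ≡ x
  +ᴷ--ᴷ-cancel (a , b) (c , e) = cong₂ _,_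
    (solve 2 (λ a c → a :+ c :- c := a) refl a c)
    (solve 2 (λ b e → b :+ e :- e := b) refl b e)

  x·conj[x]≡norm : ∀ x → x · conj x ≡ fromℚ (norm x)
  x·conj[x]≡norm (a , b) = cong₂ _,_
    (solve 3 (λ a b D → a :* a :- D :* (b :* (:- b)) := a :* a :+ D :* (b :* b)) refl a b D)
    (solve 2 (λ a b → a :* (:- b) :+ b :* a := con 0ℚ) refl a b)

  x+conj[x]≡trace : ∀ a b → (a , b) +ᴷ conj (a , b) ≡ fromℚ (a ℚ.+ a)
  x+conj[x]≡trace a b = cong (a ℚ.+ a ,_) (ℚP.+-inverseʳ b)

  √-d·√-d : √-d · √-d ≡ -ᴷ ι d
  √-d·√-d = cong₂ _,_
    (solve 1 (λ D → con 0ℚ :* con 0ℚ :- D :* (con 1ℚ :* con 1ℚ) := :- D) refl D)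
    refl

  x≡a+b√-d : ∀ a b → (a , b) ≡ fromℚ a +ᴷ fromℚ b · √-d
  x≡a+b√-d a b = cong₂ _,_
    (solve 3 (λ a b D → a := a :+ (b :* con 0ℚ :- D :* (con 0ℚ :* con 1ℚ))) refl a b D)
    (solve 1 (λ b → b := con 0ℚ :+ (b :* con 1ℚ :+ con 0ℚ :* con 0ℚ)) refl b)

  ι-suc : ∀ n → ι (suc n) ≡ 1K +ᴷ ι n
  ι-suc n = trans (cong fromℚ (ℕ→ℚ-+ 1 n)) (sym (fromℚ-+ 1ℚ (ℕ→ℚ n)))

  ι-* : ∀ m n → ι (m ℕ.* n) ≡ ι m · ι n
  ι-* m n = trans (cong fromℚ (ℕ→ℚ-* m n)) (sym (fromℚ-· (ℕ→ℚ m) (ℕ→ℚ n)))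

  ι-denominator : ∀ r → fromℚ r · ι (ℚ.↧ₙ r) ≡ fromℚ (ℚ.↥ r / 1)
  ι-denominator r = trans (fromℚ-· r (ℕ→ℚ (ℚ.↧ₙ r))) (cong fromℚ (*-denominator r))

  scale-by-norm : ∀ x c e → (norm x ℚ.* c , norm x ℚ.* e) ≡ conj x · (x · (c , e))
  scale-by-norm (a , b) c e = cong₂ _,_
    (solve 5 (λ a b c e D → (a :* a :+ D :* (b :* b)) :* c
                := a :* (a :* c :- D :* (b :* e)) :- D :* ((:- b) :* (a :* e :+ b :* c))) refl a b c e D)
    (solve 5 (λ a b c e D → (a :* a :+ D :* (b :* b)) :* e
                := a :* (a :* e :+ b :* c) :+ (:- b) :* (a :* c :- D :* (b :* e))) refl a b c e D)

  _≟ᴷ_ : DecidableEquality K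
  _≟ᴷ_ = ≡-dec ℚP._≟_ ℚP._≟_

  1K≢0K : 1K ≢ 0K
  1K≢0K ()

  fromℚ-≢0 : ∀ {r} → r ≢ 0ℚ → fromℚ r ≢ 0K
  fromℚ-≢0 r≢0 r≡0 = r≢0 (cong proj₁ r≡0)

  ι-≢0 : ∀ {n} → n ≢ 0 → ι n ≢ 0K
  ι-≢0 n≢0 ιn≡0 = n≢0 (ℕ→ℚ-≡0 (cong proj₁ ιn≡0))

  √-d≢0K : √-d ≢ 0K
  √-d≢0K ()

  -ᴷ-≢0 : ∀ {x} → x ≢ 0K → -ᴷ x ≢ 0K
  -ᴷ-≢0 {a , b} x≢0 -x≡0 = x≢0 (cong₂ _,_ (ℚP.neg-injective (cong proj₁ -x≡0)) (ℚP.neg-injective (cong proj₂ -x≡0)))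

  conj-≢0 : ∀ {x} → x ≢ 0K → conj x ≢ 0K
  conj-≢0 {a , b} x≢0 x̄≡0 = x≢0 (cong₂ _,_ (cong proj₁ x̄≡0) (ℚP.neg-injective (cong proj₂ x̄≡0)))

  ·≡1⇒≢0ˡ : ∀ x y → x · y ≡ 1K → x ≢ 0K
  ·≡1⇒≢0ˡ x y xy≡1 refl = 1K≢0K (trans (sym xy≡1) (·-zeroˡ y))

  ·≡1⇒≢0ʳ : ∀ x y → x · y ≡ 1K → y ≢ 0K
  ·≡1⇒≢0ʳ x y xy≡1 refl = 1K≢0K (trans (sym xy≡1) (·-zeroʳ x))

  module _ .{{_ : ℕ.NonZero d}} where

    private
      D>0 : 0ℚ ℚ.< D
      D>0 = ℚP.positive⁻¹ D {{ℚP.normalize-pos d 1}}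

      D*-mono-< : ∀ {q} → 0ℚ ℚ.< q → 0ℚ ℚ.< D ℚ.* q
      D*-mono-< {q} 0<q = subst (ℚ._< D ℚ.* q) (ℚP.*-zeroʳ D) (ℚP.*-monoʳ-<-pos D {{ℚ.positive D>0}} 0<q)

      D*-mono-≤ : ∀ {q} → 0ℚ ℚ.≤ q → 0ℚ ℚ.≤ D ℚ.* q
      D*-mono-≤ {q} 0≤q = subst (ℚ._≤ D ℚ.* q) (ℚP.*-zeroʳ D)
        (ℚP.*-monoˡ-≤-nonNeg D {{ℚP.pos⇒nonNeg D {{ℚ.positive D>0}}}} 0≤q)

    norm>0 : ∀ {x} → x ≢ 0K → 0ℚ ℚ.< norm x
    norm>0 {a , b} x≢0 with a ℚP.≟ 0ℚ | b ℚP.≟ 0ℚ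
    ... | yes refl | yes refl = contradiction refl x≢0
    ... | yes refl | no b≢0 = ℚP.+-mono-≤-< (p*p≥0 0ℚ) (D*-mono-< (p≢0⇒p*p>0 b≢0))
    ... | no a≢0 | _ = ℚP.+-mono-<-≤ (p≢0⇒p*p>0 a≢0) (D*-mono-≤ (p*p≥0 b))

    norm≢0 : ∀ {x} → x ≢ 0K → norm x ≢ 0ℚ
    norm≢0 x≢0 = ℚP.<⇒≢ (norm>0 x≢0) ∘ sym

    ·-≢0 : ∀ {x y} → x ≢ 0K → y ≢ 0K → x · y ≢ 0K
    ·-≢0 {x} {c , e} x≢0 y≢0 xy≡0 =
      y≢0 (cong₂ _,_ (p≢0∧p*q≡0⇒q≡0 N≢0 (cong proj₁ Nc,Ne≡0)) (p≢0∧p*q≡0⇒q≡0 N≢0 (cong proj₂ Nc,Ne≡0)))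
      where
      N≢0 : norm x ≢ 0ℚ
      N≢0 = norm≢0 x≢0
      Nc,Ne≡0 : (norm x ℚ.* c , norm x ℚ.* e) ≡ 0K
      Nc,Ne≡0 = trans (scale-by-norm x c e) (trans (cong (conj x ·_) xy≡0) (·-zeroʳ (conj x)))

    powK-≢0 : ∀ {x} n → x ≢ 0K → powK d x n ≢ 0K
    powK-≢0 zero _ = 1K≢0K
    powK-≢0 (suc n) x≢0 = ·-≢0 x≢0 (powK-≢0 n x≢0)

    pPow-≢0 : ∀ {k} (ps : Vec ℕ k) (β : Vec (Fin 5) k) → (∀ j → lookup ps j ≢ 0) → pPow d ps β ≢ 0K
    pPow-≢0 [] [] _ = 1K≢0K
    pPow-≢0 (p ∷ ps) (b ∷ β) ps≢0 = ·-≢0 (powK-≢0 (toℕ b) (ι-≢0 (ps≢0 Fin.zero))) (pPow-≢0 ps β (ps≢0 ∘ Fin.suc))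

module ValuationProperties {d : ℕ} .{{_ : ℕ.NonZero d}} (w : Valuation d) where
  open QuadraticField d

  v-1 : v w 1K ≡ + 0
  v-1 = +-identityʳ-unique (v w 1K) (v w 1K)
    (trans (sym (v-mul w 1K 1K 1K≢0K 1K≢0K)) (cong (v w) (·-identityˡ 1K)))

  v-neg : ∀ {x} → x ≢ 0K → v w (-ᴷ x) ≡ v w x
  v-neg {x} x≢0 = begin
    v w (-ᴷ x)                   ≡⟨ cong (v w) (-ᴷ-as-· x) ⟩
    v w (-1ᴷ · x)                 ≡⟨ v-mul w -1ᴷ x -1ᴷ≢0 x≢0 ⟩
    v w -1ᴷ ℤ.+ v w x             ≡⟨ cong (ℤ._+ v w x) v[-1ᴷ]≡0 ⟩
    + 0 ℤ.+ v w x                ≡⟨ ℤP.+-identityˡ (v w x) ⟩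
    v w x                        ∎
    where
    open ≡-Reasoning
    -1ᴷ : K
    -1ᴷ = fromℚ (ℚ.- 1ℚ)
    -1ᴷ≢0 : -1ᴷ ≢ 0K
    -1ᴷ≢0 ()
    v[-1ᴷ]≡0 : v w -1ᴷ ≡ + 0
    v[-1ᴷ]≡0 = i+i≡j+j⇒i≡j (trans (sym (v-mul w -1ᴷ -1ᴷ -1ᴷ≢0 -1ᴷ≢0)) (trans (cong (v w) (fromℚ-· (ℚ.- 1ℚ) (ℚ.- 1ℚ))) v-1))

  v-inverse : ∀ {x y} → x · y ≡ 1K → v w x ℤ.+ v w y ≡ + 0
  v-inverse {x} {y} xy≡1 = trans (sym (v-mul w x y (·≡1⇒≢0ˡ x y xy≡1) (·≡1⇒≢0ʳ x y xy≡1))) (trans (cong (v w) xy≡1) v-1)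

  v-·-inverse : ∀ {a b y y⁻¹} → a ≢ 0K → b ≢ 0K → y · y⁻¹ ≡ 1K →
    v w (a · b) ≡ v w y → v w (a · (b · y⁻¹)) ≡ + 0
  v-·-inverse {a} {b} {y} {y⁻¹} a≢0 b≢0 yy⁻¹≡1 v[ab]≡v[y] = begin
    v w (a · (b · y⁻¹))              ≡⟨ v-mul w a (b · y⁻¹) a≢0 (·-≢0 b≢0 y⁻¹≢0) ⟩
    v w a ℤ.+ v w (b · y⁻¹)          ≡⟨ cong (ℤ._+_ (v w a)) (v-mul w b y⁻¹ b≢0 y⁻¹≢0) ⟩
    v w a ℤ.+ (v w b ℤ.+ v w y⁻¹)    ≡⟨ ℤP.+-assoc (v w a) (v w b) (v w y⁻¹) ⟨
    v w a ℤ.+ v w b ℤ.+ v w y⁻¹      ≡⟨ cong (ℤ._+ v w y⁻¹) (trans (sym (v-mul w a b a≢0 b≢0)) v[ab]≡v[y]) ⟩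
    v w y ℤ.+ v w y⁻¹                ≡⟨ v-inverse yy⁻¹≡1 ⟩
    + 0                              ∎
    where
    open ≡-Reasoning
    y⁻¹≢0 : y⁻¹ ≢ 0K
    y⁻¹≢0 = ·≡1⇒≢0ʳ y y⁻¹ yy⁻¹≡1

  v-+-< : ∀ {x y} → x ≢ 0K → y ≢ 0K → x +ᴷ y ≢ 0K → v w x ℤ.< v w y → v w (x +ᴷ y) ≡ v w x
  v-+-< {x} {y} x≢0 y≢0 s≢0 vx<vy = ℤP.≤-antisym vs≤vx vx≤vs
    where
    s : K
    s = x +ᴷ y
    vx≤vs : v w x ℤ.≤ v w s
    vx≤vs = subst (ℤ._≤ v w s) (ℤP.i≤j⇒i⊓j≡i (ℤP.<⇒≤ vx<vy)) (v-ultr w x y x≢0 y≢0 s≢0)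
    x≢0′ : s +ᴷ -ᴷ y ≢ 0K
    x≢0′ = subst (_≢ 0K) (sym (+ᴷ--ᴷ-cancel x y)) x≢0
    vs⊓vy≤vx : v w s ⊓ v w y ℤ.≤ v w x
    vs⊓vy≤vx = subst₂ (λ t u → v w s ⊓ t ℤ.≤ v w u) (v-neg y≢0) (+ᴷ--ᴷ-cancel x y)
                 (v-ultr w s (-ᴷ y) s≢0 (-ᴷ-≢0 y≢0) x≢0′)
    vs≤vx : v w s ℤ.≤ v w x
    vs≤vx with ℤP.⊓-sel (v w s) (v w y)
    ... | inj₁ min≡vs = subst (ℤ._≤ v w x) min≡vs vs⊓vy≤vx
    ... | inj₂ min≡vy = contradiction (subst (ℤ._≤ v w x) min≡vy vs⊓vy≤vx) (ℤP.<⇒≱ vx<vy)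

  v-+ : ∀ {x y} → x ≢ 0K → y ≢ 0K → x +ᴷ y ≢ 0K → UltrametricValue (v w x) (v w y) (v w (x +ᴷ y))
  v-+ {x} {y} x≢0 y≢0 s≢0 = v-ultr w x y x≢0 y≢0 s≢0 , strict
    where
    strict : v w x ≢ v w y → v w (x +ᴷ y) ≡ v w x ⊓ v w y
    strict vx≢vy with ℤP.<-cmp (v w x) (v w y)
    ... | tri< vx<vy _ _ = trans (v-+-< x≢0 y≢0 s≢0 vx<vy) (sym (ℤP.i≤j⇒i⊓j≡i (ℤP.<⇒≤ vx<vy)))
    ... | tri≈ _ vx≡vy _ = contradiction vx≡vy vx≢vy
    ... | tri> _ _ vy<vx = begin
      v w (x +ᴷ y)       ≡⟨ cong (v w) (+ᴷ-comm x y) ⟩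
      v w (y +ᴷ x)       ≡⟨ v-+-< y≢0 x≢0 (subst (_≢ 0K) (+ᴷ-comm x y) s≢0) vy<vx ⟩
      v w y              ≡⟨ ℤP.i≥j⇒i⊓j≡j (ℤP.<⇒≤ vy<vx) ⟨
      v w x ⊓ v w y      ∎
      where open ≡-Reasoning

  -- v w 0K is unconstrained, hence the guard.
  Integral : K → Set
  Integral x = x ≢ 0K → + 0 ℤ.≤ v w x

  integral-+ : ∀ {x y} → Integral x → Integral y → Integral (x +ᴷ y)
  integral-+ {x} {y} x-int y-int s≢0 with x ≟ᴷ 0K | y ≟ᴷ 0K
  ... | yes refl | _ = subst Integral (sym (+ᴷ-identityˡ y)) y-int s≢0
  ... | no _ | yes refl = subst Integral (sym (trans (+ᴷ-comm x 0K) (+ᴷ-identityˡ x))) x-int s≢0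
  ... | no x≢0 | no y≢0 = ℤP.≤-trans (ℤP.⊓-glb (x-int x≢0) (y-int y≢0)) (v-ultr w x y x≢0 y≢0 s≢0)

  integral-· : ∀ {x y} → Integral x → Integral y → Integral (x · y)
  integral-· {x} {y} x-int y-int xy≢0 =
    subst (+ 0 ℤ.≤_) (sym (v-mul w x y x≢0 y≢0)) (ℤP.+-mono-≤ (x-int x≢0) (y-int y≢0))
    where
    x≢0 : x ≢ 0K
    x≢0 refl = xy≢0 (·-zeroˡ y)
    y≢0 : y ≢ 0K
    y≢0 refl = xy≢0 (·-zeroʳ x)

  integral-ι : ∀ n → Integral (ι n)
  integral-ι zero 0≢0 = contradiction refl 0≢0
  integral-ι (suc n) = subst Integral (sym (ι-suc n))
    (integral-+ (λ _ → ℤP.≤-reflexive (sym v-1)) (integral-ι n))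

  v-ι-nonneg : ∀ {n} → n ≢ 0 → + 0 ℤ.≤ v w (ι n)
  v-ι-nonneg {n} n≢0 = integral-ι n (ι-≢0 n≢0)

  integral-√-d : Integral √-d
  integral-√-d _ with + 0 ℤP.≤? v w √-d
  ... | yes 0≤v = 0≤v
  ... | no 0≰v = contradiction (v-ι-nonneg (ℕ.≢-nonZero⁻¹ d)) (ℤP.<⇒≱ (begin-strict
    v w (ι d)             ≡⟨ v-neg (ι-≢0 (ℕ.≢-nonZero⁻¹ d)) ⟨
    v w (-ᴷ ι d)          ≡⟨ cong (v w) √-d·√-d ⟨
    v w (√-d · √-d)       ≡⟨ v-mul w √-d √-d √-d≢0K √-d≢0K ⟩
    v w √-d ℤ.+ v w √-d   <⟨ ℤP.+-mono-< (ℤP.≰⇒> 0≰v) (ℤP.≰⇒> 0≰v) ⟩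
    + 0                   ∎))
    where open ℤP.≤-Reasoning

  v-fromℤ : ∀ i → i ≢ + 0 → v w (fromℚ (i / 1)) ≡ v w (ι ℤ.∣ i ∣)
  v-fromℤ (+ n) _ = refl
  v-fromℤ -[1+ n ] _ = v-neg (ι-≢0 {suc n} (λ ()))

  v-fromℚ : ∀ {r} → r ≢ 0ℚ → v w (fromℚ r) ℤ.+ v w (ι (ℚ.↧ₙ r)) ≡ v w (ι ℤ.∣ ℚ.↥ r ∣)
  v-fromℚ {r} r≢0 = begin
    v w (fromℚ r) ℤ.+ v w (ι (ℚ.↧ₙ r))    ≡⟨ v-mul w (fromℚ r) (ι (ℚ.↧ₙ r)) (fromℚ-≢0 r≢0) (ι-≢0 {ℚ.↧ₙ r} (λ ())) ⟨
    v w (fromℚ r · ι (ℚ.↧ₙ r))            ≡⟨ cong (v w) (ι-denominator r) ⟩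
    v w (fromℚ (ℚ.↥ r / 1))               ≡⟨ v-fromℤ (ℚ.↥ r) (r≢0 ∘ ℚP.↥p≡0⇒p≡0 r) ⟩
    v w (ι ℤ.∣ ℚ.↥ r ∣)                   ∎
    where open ≡-Reasoning

  integral-fromℚ : ∀ {r} → v w (ι (ℚ.↧ₙ r)) ≡ + 0 → Integral (fromℚ r)
  integral-fromℚ {r} v[↧r]≡0 fromℚr≢0 = subst (+ 0 ℤ.≤_) v[r]≡v[↥r] (v-ι-nonneg (r≢0 ∘ ℚP.↥p≡0⇒p≡0 r ∘ ℤP.∣i∣≡0⇒i≡0))
    where
    r≢0 : r ≢ 0ℚ
    r≢0 refl = fromℚr≢0 refl
    v[r]≡v[↥r] : v w (ι ℤ.∣ ℚ.↥ r ∣) ≡ v w (fromℚ r)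
    v[r]≡v[↥r] = trans (sym (v-fromℚ r≢0)) (trans (cong (ℤ._+_ (v w (fromℚ r))) v[↧r]≡0) (ℤP.+-identityʳ _))

  integral-pair : ∀ {a b} → v w (ι (ℚ.↧ₙ a)) ≡ + 0 → v w (ι (ℚ.↧ₙ b)) ≡ + 0 → Integral (a , b)
  integral-pair {a} {b} v[↧a]≡0 v[↧b]≡0 = subst Integral (sym (x≡a+b√-d a b))
    (integral-+ (integral-fromℚ {a} v[↧a]≡0) (integral-· (integral-fromℚ {b} v[↧b]≡0) integral-√-d))

  v-ι-additive : CompletelyAdditive (λ n → v w (ι n))
  v-ι-additive = record { additive = λ m n m≢0 n≢0 →
    trans (cong (v w) (ι-* m n)) (v-mul w (ι m) (ι n) (ι-≢0 m≢0) (ι-≢0 n≢0)) }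

  v-ι-suc : ∀ {n} → n ≢ 0 → + 0 ℤ.< v w (ι n) → v w (ι (suc n)) ≡ + 0
  v-ι-suc {n} n≢0 0<vn = begin
    v w (ι (suc n))    ≡⟨ cong (v w) (ι-suc n) ⟩
    v w (1K +ᴷ ι n)    ≡⟨ v-+-< 1K≢0K (ι-≢0 n≢0) (subst (_≢ 0K) (ι-suc n) (ι-≢0 {suc n} (λ ())))
                                (subst (ℤ._< v w (ι n)) (sym v-1) 0<vn) ⟩
    v w 1K             ≡⟨ v-1 ⟩
    + 0                ∎
    where open ≡-Reasoning

  open NonArchimedeanOnℕ v-ι-additive v-ι-nonneg v-ι-suc public using (other-prime⇒zero)

  -- An element of valuation -1 cannot have both coordinates with denominators of valuation 0.
  v-ι-positive : ∃ λ n → n ≢ 0 × + 0 ℤ.< v w (ι n)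
  v-ι-positive with v-surj w -[1+ 0 ]
  ... | (a , b) , α≢0 , vα≡-1 with + 0 ℤP.<? v w (ι (ℚ.↧ₙ a)) | + 0 ℤP.<? v w (ι (ℚ.↧ₙ b))
  ... | yes 0<v[↧a] | _ = ℚ.↧ₙ a , (λ ()) , 0<v[↧a]
  ... | no _ | yes 0<v[↧b] = ℚ.↧ₙ b , (λ ()) , 0<v[↧b]
  ... | no 0≮v[↧a] | no 0≮v[↧b] =
    contradiction (subst (+ 0 ℤ.≤_) vα≡-1 (integral-pair {a} {b} (unit a 0≮v[↧a]) (unit b 0≮v[↧b]) α≢0)) λ ()
    where
    unit : ∀ r → ¬ (+ 0 ℤ.< v w (ι (ℚ.↧ₙ r))) → v w (ι (ℚ.↧ₙ r)) ≡ + 0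
    unit r 0≮v = ℤP.≤-antisym (ℤP.≮⇒≥ 0≮v) (v-ι-nonneg {ℚ.↧ₙ r} (λ ()))

  residue-prime : ∃ λ p → Prime p × + 0 ℤ.< v w (ι p)
  residue-prime with v-ι-positive
  ... | n , n≢0 , 0<vn = positive-prime-factor v-ι-additive n n≢0 0<vn

  v-norm : ∀ {x} → x ≢ 0K → v w x ℤ.+ v w (conj x) ≡ v w (fromℚ (norm x))
  v-norm {x} x≢0 = trans (sym (v-mul w x (conj x) x≢0 (conj-≢0 x≢0))) (cong (v w) (x·conj[x]≡norm x))

  v-trace : ∀ {a b} → a ≢ 0ℚ → (a , b) ≢ 0K →
    UltrametricValue (v w (a , b)) (v w (conj (a , b))) (v w (fromℚ (a ℚ.+ a)))
  v-trace {a} {b} a≢0 x≢0 = subst (UltrametricValue (v w (a , b)) (v w (conj (a , b))) ∘ v w) (x+conj[x]≡trace a b)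
    (v-+ x≢0 (conj-≢0 x≢0) (subst (_≢ 0K) (sym (x+conj[x]≡trace a b)) (fromℚ-≢0 (a+a≢0 a≢0))))

  v-powK : ∀ {x} n → x ≢ 0K → v w (powK d x n) ≡ + n ℤ.* v w x
  v-powK {x} zero _ = trans v-1 (sym (ℤP.*-zeroˡ (v w x)))
  v-powK {x} (suc n) x≢0 = begin
    v w (x · powK d x n)             ≡⟨ v-mul w x (powK d x n) x≢0 (powK-≢0 n x≢0) ⟩
    v w x ℤ.+ v w (powK d x n)       ≡⟨ cong (ℤ._+_ (v w x)) (v-powK n x≢0) ⟩
    v w x ℤ.+ + n ℤ.* v w x          ≡⟨ ℤP.suc-* (+ n) (v w x) ⟨
    + suc n ℤ.* v w x                ∎
    where open ≡-Reasoning

  v-pPow-∷ : ∀ {k} p (ps : Vec ℕ k) b β → (∀ j → lookup (p ∷ ps) j ≢ 0) →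
    v w (pPow d (p ∷ ps) (b ∷ β)) ≡ + toℕ b ℤ.* v w (ι p) ℤ.+ v w (pPow d ps β)
  v-pPow-∷ p ps b β ps≢0 = trans
    (v-mul w _ _ (powK-≢0 (toℕ b) (ι-≢0 (ps≢0 Fin.zero))) (pPow-≢0 ps β (ps≢0 ∘ Fin.suc)))
    (cong (ℤ._+ v w (pPow d ps β)) (v-powK (toℕ b) (ι-≢0 (ps≢0 Fin.zero))))

  v-pPow-units : ∀ {k} (ps : Vec ℕ k) (β : Vec (Fin 5) k) → (∀ j → lookup ps j ≢ 0) →
    (∀ j → v w (ι (lookup ps j)) ≡ + 0) → v w (pPow d ps β) ≡ + 0
  v-pPow-units [] [] _ _ = v-1
  v-pPow-units (p ∷ ps) (b ∷ β) ps≢0 v[ps]≡0 = begin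
    v w (pPow d (p ∷ ps) (b ∷ β))                    ≡⟨ v-pPow-∷ p ps b β ps≢0 ⟩
    + toℕ b ℤ.* v w (ι p) ℤ.+ v w (pPow d ps β)      ≡⟨ cong₂ (λ s t → + toℕ b ℤ.* s ℤ.+ t) (v[ps]≡0 Fin.zero)
                                                          (v-pPow-units ps β (ps≢0 ∘ Fin.suc) (v[ps]≡0 ∘ Fin.suc)) ⟩
    + toℕ b ℤ.* + 0 ℤ.+ + 0                          ≡⟨ cong (ℤ._+ + 0) (ℤP.*-zeroʳ (+ toℕ b)) ⟩
    + 0                                              ∎
    where open ≡-Reasoning

  v-pPow-single : ∀ {k} (ps : Vec ℕ k) (β : Vec (Fin 5) k) i → (∀ j → lookup ps j ≢ 0) →
    (∀ j → j ≢ i → v w (ι (lookup ps j)) ≡ + 0) →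
    v w (pPow d ps β) ≡ + toℕ (lookup β i) ℤ.* v w (ι (lookup ps i))
  v-pPow-single (p ∷ ps) (b ∷ β) Fin.zero ps≢0 v[ps]≡0 = begin
    v w (pPow d (p ∷ ps) (b ∷ β))                    ≡⟨ v-pPow-∷ p ps b β ps≢0 ⟩
    + toℕ b ℤ.* v w (ι p) ℤ.+ v w (pPow d ps β)      ≡⟨ cong (ℤ._+_ (+ toℕ b ℤ.* v w (ι p)))
                                                          (v-pPow-units ps β (ps≢0 ∘ Fin.suc) (λ j → v[ps]≡0 (Fin.suc j) λ ())) ⟩
    + toℕ b ℤ.* v w (ι p) ℤ.+ + 0                    ≡⟨ ℤP.+-identityʳ _ ⟩
    + toℕ b ℤ.* v w (ι p)                            ∎
    where open ≡-Reasoning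
  v-pPow-single (p ∷ ps) (b ∷ β) (Fin.suc i) ps≢0 v[ps]≡0 = begin
    v w (pPow d (p ∷ ps) (b ∷ β))                    ≡⟨ v-pPow-∷ p ps b β ps≢0 ⟩
    + toℕ b ℤ.* v w (ι p) ℤ.+ v w (pPow d ps β)      ≡⟨ cong₂ (λ s t → + toℕ b ℤ.* s ℤ.+ t) (v[ps]≡0 Fin.zero λ ())
                                                          (v-pPow-single ps β i (ps≢0 ∘ Fin.suc) (λ j j≢i → v[ps]≡0 (Fin.suc j) (j≢i ∘ FinP.suc-injective))) ⟩
    + toℕ b ℤ.* + 0 ℤ.+ + toℕ (lookup β i) ℤ.* v w (ι (lookup ps i))
                                                     ≡⟨ cong (ℤ._+ _) (ℤP.*-zeroʳ (+ toℕ b)) ⟩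
    + 0 ℤ.+ + toℕ (lookup β i) ℤ.* v w (ι (lookup ps i))
                                                     ≡⟨ ℤP.+-identityˡ _ ⟩
    + toℕ (lookup β i) ℤ.* v w (ι (lookup ps i))     ∎
    where open ≡-Reasoning

module PlacesAbovePrime {d : ℕ} .{{_ : ℕ.NonZero d}} (w w′ : Valuation d) {p : ℕ} (p-prime : Prime p)
  (0<e : + 0 ℤ.< v w (ι p)) (0<e′ : + 0 ℤ.< v w′ (ι p)) where

  open QuadraticField d
  private
    module V = ValuationProperties w
    module V′ = ValuationProperties w′

  e e′ : ℤ
  e = v w (ι p)
  e′ = v w′ (ι p)

  agree-on-ℕ : ∀ n → n ≢ 0 → e′ ℤ.* v w (ι n) ≡ e ℤ.* v w′ (ι n)
  agree-on-ℕ = agree-on-primes⇒agree (completelyAdditive-scale e′ V.v-ι-additive)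
                                      (completelyAdditive-scale e V′.v-ι-additive) on-primes
    where
    on-primes : ∀ q → Prime q → e′ ℤ.* v w (ι q) ≡ e ℤ.* v w′ (ι q)
    on-primes q q-prime with p ℕ.≟ q
    ... | yes refl = ℤP.*-comm e′ e
    ... | no p≢q = begin
      e′ ℤ.* v w (ι q)     ≡⟨ cong (e′ ℤ.*_) (V.other-prime⇒zero p-prime q-prime p≢q 0<e) ⟩
      e′ ℤ.* + 0           ≡⟨ ℤP.*-zeroʳ e′ ⟩
      + 0                  ≡⟨ ℤP.*-zeroʳ e ⟨
      e ℤ.* + 0            ≡⟨ cong (e ℤ.*_) (V′.other-prime⇒zero p-prime q-prime p≢q 0<e′) ⟨
      e ℤ.* v w′ (ι q)     ∎
      where open ≡-Reasoning

  agree-on-ℚ : ∀ {r} → r ≢ 0ℚ → e′ ℤ.* v w (fromℚ r) ≡ e ℤ.* v w′ (fromℚ r)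
  agree-on-ℚ {r} r≢0 = +-cancelʳ (e ℤ.* v w′ (ι (ℚ.↧ₙ r))) _ _ (begin
    e′ ℤ.* v w (fromℚ r) ℤ.+ e ℤ.* v w′ (ι (ℚ.↧ₙ r))      ≡⟨ cong (ℤ._+_ (e′ ℤ.* v w (fromℚ r))) (agree-on-ℕ (ℚ.↧ₙ r) (λ ())) ⟨
    e′ ℤ.* v w (fromℚ r) ℤ.+ e′ ℤ.* v w (ι (ℚ.↧ₙ r))      ≡⟨ ℤP.*-distribˡ-+ e′ _ _ ⟨
    e′ ℤ.* (v w (fromℚ r) ℤ.+ v w (ι (ℚ.↧ₙ r)))           ≡⟨ cong (e′ ℤ.*_) (V.v-fromℚ r≢0) ⟩
    e′ ℤ.* v w (ι ℤ.∣ ℚ.↥ r ∣)                            ≡⟨ agree-on-ℕ ℤ.∣ ℚ.↥ r ∣ (r≢0 ∘ ℚP.↥p≡0⇒p≡0 r ∘ ℤP.∣i∣≡0⇒i≡0) ⟩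
    e ℤ.* v w′ (ι ℤ.∣ ℚ.↥ r ∣)                            ≡⟨ cong (e ℤ.*_) (V′.v-fromℚ r≢0) ⟨
    e ℤ.* (v w′ (fromℚ r) ℤ.+ v w′ (ι (ℚ.↧ₙ r)))          ≡⟨ ℤP.*-distribˡ-+ e _ _ ⟩
    e ℤ.* v w′ (fromℚ r) ℤ.+ e ℤ.* v w′ (ι (ℚ.↧ₙ r))      ∎)
    where open ≡-Reasoning

  private
    instance
      e≥0 : ℤ.NonNegative e
      e≥0 = ℤ.nonNegative (ℤP.<⇒≤ 0<e)
      e′≥0 : ℤ.NonNegative e′
      e′≥0 = ℤ.nonNegative (ℤP.<⇒≤ 0<e′)

    conjugates-sum : ∀ {γ} → γ ≢ 0K →
      e′ ℤ.* v w γ ℤ.+ e′ ℤ.* v w (conj γ) ≡ e ℤ.* v w′ γ ℤ.+ e ℤ.* v w′ (conj γ)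
    conjugates-sum {γ} γ≢0 = begin
      e′ ℤ.* v w γ ℤ.+ e′ ℤ.* v w (conj γ)     ≡⟨ ℤP.*-distribˡ-+ e′ _ _ ⟨
      e′ ℤ.* (v w γ ℤ.+ v w (conj γ))          ≡⟨ cong (e′ ℤ.*_) (V.v-norm γ≢0) ⟩
      e′ ℤ.* v w (fromℚ (norm γ))              ≡⟨ agree-on-ℚ (norm≢0 γ≢0) ⟩
      e ℤ.* v w′ (fromℚ (norm γ))              ≡⟨ cong (e ℤ.*_) (V′.v-norm γ≢0) ⟨
      e ℤ.* (v w′ γ ℤ.+ v w′ (conj γ))         ≡⟨ ℤP.*-distribˡ-+ e _ _ ⟩
      e ℤ.* v w′ γ ℤ.+ e ℤ.* v w′ (conj γ)     ∎
      where open ≡-Reasoning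

  -- γ and conj γ are the roots of t² - trace γ · t + norm γ, whose coefficients are rational, where
  -- the two scaled valuations agree; so both see the same pair of values {v γ, v (conj γ)}.
  conjugate-or-equal : ∀ {γ} → γ ≢ 0K →
    e ℤ.* v w′ γ ≡ e′ ℤ.* v w γ ⊎ e ℤ.* v w′ γ ≡ e′ ℤ.* v w (conj γ)
  conjugate-or-equal {γ@(a , b)} γ≢0 with a ℚP.≟ 0ℚ
  ... | yes refl = inj₁ (sym (i+i≡j+j⇒i≡j (subst₂ (λ s t → e′ ℤ.* v w γ ℤ.+ e′ ℤ.* s ≡ e ℤ.* v w′ γ ℤ.+ e ℤ.* t)
                          (V.v-neg γ≢0) (V′.v-neg γ≢0) (conjugates-sum γ≢0))))
  ... | no a≢0 = ultrametricValue-pair (conjugates-sum γ≢0)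
    (ultrametricValue-scale e′ (V.v-trace a≢0 γ≢0))
    (subst (UltrametricValue (e ℤ.* v w′ γ) (e ℤ.* v w′ (conj γ))) (sym (agree-on-ℚ (a+a≢0 a≢0)))
      (ultrametricValue-scale e (V′.v-trace a≢0 γ≢0)))

  root-transfer : ∀ n {γ} → γ ≢ 0K → n ℤ.* e′ ℤ.+ v w′ γ ≡ + 0 →
    n ℤ.* e ℤ.+ v w γ ≡ + 0 ⊎ n ℤ.* e ℤ.+ v w (conj γ) ≡ + 0
  root-transfer n γ≢0 root′ = Sum.map (proportional⇒same-root n e′≢0 root′)
                                      (proportional⇒same-root n e′≢0 root′) (conjugate-or-equal γ≢0)
    where
    e′≢0 : e′ ≢ + 0
    e′≢0 = ℤP.<⇒≢ 0<e′ ∘ sym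

module PrimesBelow {d : ℕ} .{{_ : ℕ.NonZero d}} (S : List (Valuation d)) {k : ℕ} (ps : Vec ℕ k)
  (ps-unique : Unique ps) (ps⇔below : ∀ p → (p ∈ ps) ⇔ BelowS S p) where

  open QuadraticField d

  private
    below : ∀ i → BelowS S (lookup ps i)
    below i = Equivalence.to (ps⇔below (lookup ps i)) (∈-lookup i ps)

  ps-prime : ∀ i → Prime (lookup ps i)
  ps-prime i = proj₁ (below i)

  ps≢0 : ∀ i → lookup ps i ≢ 0
  ps≢0 i = prime≢0 (ps-prime i)

  reference : Fin k → Valuation d
  reference i = proj₁ (ListAny.satisfied (proj₂ (below i)))

  reference-above : ∀ i → + 0 ℤ.< v (reference i) (ι (lookup ps i))
  reference-above i = proj₂ (ListAny.satisfied (proj₂ (below i)))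

  e₀ : Fin k → ℤ.ℤ
  e₀ i = v (reference i) (ι (lookup ps i))

  index-above : ∀ {w : Valuation d} → w List.∈ S → ∃ λ i → + 0 ℤ.< v w (ι (lookup ps i))
  index-above {w} w∈S = VecAny.index q∈ps , subst (λ q → + 0 ℤ.< v w (ι q)) (lookup-index q∈ps) 0<vq
    where
    open ValuationProperties w using (residue-prime)
    q : ℕ
    q = proj₁ residue-prime
    0<vq : + 0 ℤ.< v w (ι q)
    0<vq = proj₂ (proj₂ residue-prime)
    q∈ps : q ∈ ps
    q∈ps = Equivalence.from (ps⇔below q)
      (proj₁ (proj₂ residue-prime) , ListAny.map (λ w≡u → subst (λ u → + 0 ℤ.< v u (ι q)) w≡u 0<vq) w∈S)

  v-pPow-above : ∀ (w : Valuation d) i → + 0 ℤ.< v w (ι (lookup ps i)) → ∀ β →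
    v w (pPow d ps β) ≡ + toℕ (lookup β i) ℤ.* v w (ι (lookup ps i))
  v-pPow-above w i 0<vpᵢ β = v-pPow-single ps β i ps≢0 λ j j≢i →
    other-prime⇒zero (ps-prime i) (ps-prime j) (j≢i ∘ sym ∘ lookup-injective ps-unique i j) 0<vpᵢ
    where open ValuationProperties w

  v-pPow·γ≢0 : ∀ (w : Valuation d) {γ} β i → + 0 ℤ.< v w (ι (lookup ps i)) → γ ≢ 0K →
    + toℕ (lookup β i) ℤ.* e₀ i ℤ.+ v (reference i) γ ≢ + 0 →
    + toℕ (lookup β i) ℤ.* e₀ i ℤ.+ v (reference i) (conj γ) ≢ + 0 →
    v w (pPow d ps β · γ) ≢ + 0
  v-pPow·γ≢0 w {γ} β i 0<vpᵢ γ≢0 misses-γ misses-γ̄ v[pβγ]≡0 =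
    [ misses-γ , misses-γ̄ ]′ (root-transfer (+ toℕ (lookup β i)) γ≢0 root)
    where
    open PlacesAbovePrime (reference i) w (ps-prime i) (reference-above i) 0<vpᵢ
    root : + toℕ (lookup β i) ℤ.* v w (ι (lookup ps i)) ℤ.+ v w γ ≡ + 0
    root = begin
      + toℕ (lookup β i) ℤ.* v w (ι (lookup ps i)) ℤ.+ v w γ   ≡⟨ cong (ℤ._+ v w γ) (v-pPow-above w i 0<vpᵢ β) ⟨
      v w (pPow d ps β) ℤ.+ v w γ                              ≡⟨ v-mul w _ _ (pPow-≢0 ps β ps≢0) γ≢0 ⟨
      v w (pPow d ps β · γ)                                    ≡⟨ v[pβγ]≡0 ⟩
      + 0                                                      ∎
      where open ≡-Reasoning

  exponents-avoiding : ∀ {γ₁ γ₂} → γ₁ ≢ 0K → γ₂ ≢ 0K → ∃ λ (β : Vec (Fin 5) k) →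
    All (λ w → v w (pPow d ps β · γ₁) ≢ + 0 × v w (pPow d ps β · γ₂) ≢ + 0) S
  exponents-avoiding {γ₁} {γ₂} γ₁≢0 γ₂≢0 =
    β , All.tabulate (λ {w} w∈S → Product.uncurry (avoids-above w) (index-above w∈S))
    where
    values : Fin k → Fin 4 → ℤ.ℤ
    values i = lookup (v (reference i) γ₁ ∷ v (reference i) (conj γ₁)
                     ∷ v (reference i) γ₂ ∷ v (reference i) (conj γ₂) ∷ [])
    choice : ∀ i → ∃ λ (b : Fin 5) → ∀ j → + toℕ b ℤ.* e₀ i ℤ.+ values i j ≢ + 0
    choice i = exponent-avoiding (e₀ i) (ℤP.<⇒≢ (reference-above i) ∘ sym) (values i)
    β : Vec (Fin 5) k
    β = tabulate (proj₁ ∘ choice)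
    misses : ∀ i j → + toℕ (lookup β i) ℤ.* e₀ i ℤ.+ values i j ≢ + 0
    misses i = subst (λ b → ∀ j → + toℕ b ℤ.* e₀ i ℤ.+ values i j ≢ + 0)
                     (sym (lookup∘tabulate (proj₁ ∘ choice) i)) (proj₂ (choice i))
    avoids-above : ∀ (w : Valuation d) i → + 0 ℤ.< v w (ι (lookup ps i)) →
      v w (pPow d ps β · γ₁) ≢ + 0 × v w (pPow d ps β · γ₂) ≢ + 0
    avoids-above w i 0<vpᵢ = v-pPow·γ≢0 w β i 0<vpᵢ γ₁≢0 (misses i (# 0)) (misses i (# 1))
                           , v-pPow·γ≢0 w β i 0<vpᵢ γ₂≢0 (misses i (# 2)) (misses i (# 3))

lemma3p1 : (d : ℕ) → 1 ≤ d → SquareFree d →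
    (S : List (Valuation d)) → S ≢ [] → DistinctPlaces S →
    (k : ℕ) (ps : Vec ℕ k) → Unique ps → (∀ p → (p ∈ ps) ⇔ BelowS S p) →
    ∀ x y z → IsSUnit d S x → IsSUnit d S y → IsSUnit d S z →
    ∃ λ (β : Vec (Fin 5) k) →
      All (λ w → (v w (mulK d (pPow d ps β) x) ≢ + 0)
               × (v w (mulK d (pPow d ps β) z) ≢ v w y)) S
lemma3p1 d 1≤d _ S _ _ k ps ps-unique ps⇔below x y z (_ , x⁻¹ , _ , xx⁻¹≡1) (_ , y⁻¹ , _ , yy⁻¹≡1) (_ , z⁻¹ , _ , zz⁻¹≡1)
  = let β , β-avoids = exponents-avoiding x≢0 (·-≢0 z≢0 y⁻¹≢0)
    in  β , All.map (λ {w} → Product.map₂ (divide-by-y β {w})) β-avoids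
  where
  instance
    d-nonZero : ℕ.NonZero d
    d-nonZero = ℕ.>-nonZero 1≤d
  open QuadraticField d
  open PrimesBelow S ps ps-unique ps⇔below
  x≢0 : x ≢ 0K
  x≢0 = ·≡1⇒≢0ˡ x x⁻¹ xx⁻¹≡1
  z≢0 : z ≢ 0K
  z≢0 = ·≡1⇒≢0ˡ z z⁻¹ zz⁻¹≡1
  y⁻¹≢0 : y⁻¹ ≢ 0K
  y⁻¹≢0 = ·≡1⇒≢0ʳ y y⁻¹ yy⁻¹≡1
  divide-by-y : ∀ β {w : Valuation d} → v w (pPow d ps β · (z · y⁻¹)) ≢ + 0 → v w (pPow d ps β · z) ≢ v w y
  divide-by-y β {w} v[pᵝzy⁻¹]≢0 v[pᵝz]≡v[y] =
    v[pᵝzy⁻¹]≢0 (ValuationProperties.v-·-inverse w (pPow-≢0 ps β ps≢0) z≢0 yy⁻¹≡1 v[pᵝz]≡v[y])
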